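{- Let $\mathbf{O}$ be an appropriate class of operators, and suppose there exist an $\mathbf{O}$-representable $C:\mathbb{N}^2\to\mathbb{N}$ and $\mathbf{O}$-representable $L,R:\mathbb{N}\to\mathbb{N}$ with $\{(u,v)\in\mathbb{N}^2\mid C(u,v)=0\}=\{(0,0)\}$ and $\{(L(s),R(s))\mid s\in\mathbb{N}\}=\mathbb{N}^2$. Let $\mathbf{M_0},\mathbf{M_1},\mathbf{M_2}$ be effective metric spaces $\mathbf{M_i}=(M_i,d_i,A_i,\alpha_i)$ with $\mathrm{dom}(\alpha_i)\subseteq\mathbb{N}$ ($i=0,1,2$), let $\theta_0$ be a conditionally $\mathbf{O}$-computable partial function from $\mathbf{M_1}$ to $\mathbf{M_0}$ and $\theta_1$ a conditionally $\mathbf{O}$-computable partial function from $\mathbf{M_2}$ to $\mathbf{M_1}$. Then the composition $\xi\mapsto\theta_0(\theta_1(\xi))$ is a conditionally $\mathbf{O}$-computable partial function from $\mathbf{M_2}$ to $\mathbf{M_0}$.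
   Context: $\mathbb{T}_m$ is the set of total functions $\mathbb{N}^m\to\mathbb{N}$; a $k$-ary operator is a map $\mathbb{T}_1^k\to\mathbb{T}_1$; $\check{c}\in\mathbb{T}_1$ is the constant function with value $c$. A class $\mathbf{O}$ of operators is appropriate if: (1) for all $k$ and $i\le k$ the operator $(f_1,\ldots,f_k)\mapsto f_i$ is in $\mathbf{O}$; (2) the operator $F(f_1,f_2)(n)=f_1(f_2(n))$ is in $\mathbf{O}$; (3) if $F$ is $k$-ary in $\mathbf{O}$ and $G_1,\ldots,G_k$ are $l$-ary in $\mathbf{O}$, then $H(g_1,\ldots,g_l)=F(G_1(g_1,\ldots,g_l),\ldots,G_k(g_1,\ldots,g_l))$ is in $\mathbf{O}$; (4) if $F$ is $(k+1)$-ary in $\mathbf{O}$, then $G(f_1,\ldots,f_k)(n)=F(f_1,\ldots,f_k,\check{n})(n)$ is in $\mathbf{O}$. For $f:\mathbb{N}^k\to\mathbb{N}$, $\mathring{f}(f_1,\ldots,f_k)(n)=f(f_1(n),\ldots,f_k(n))$; $f$ is $\mathbf{O}$-representable if $\mathring{f}\in\mathbf{O}$. An effective metric space $(M,d,A,\alpha)$ (in the sense of Weihrauch's Computable Analysis, Def. 8.1.2) consists of a metric space $(M,d)$, a dense subset $A\subseteq M$ and a notation $\alpha$ of $A$ (a surjective partial map onto $A$); here $\mathrm{dom}(\alpha)\subseteq\mathbb{N}$. An ordinary name of $\xi\in M$ is a function $f\in\mathbb{T}_1$ with $f(t)\in\mathrm{dom}(\alpha)$ and $d(\alpha(f(t)),\xi)<\frac{1}{t+1}$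 for all $t\in\mathbb{N}$. A partial function $\theta:D\to M'$, $D\subseteq M$, from $(M,d,A,\alpha)$ to $(M',d',A',\alpha')$ is conditionally $\mathbf{O}$-computable if there exist a unary operator $E\in\mathbf{O}$ and a binary operator $T\in\mathbf{O}$ such that whenever $\xi\in D$ and $f$ is an ordinary name of $\xi$, there exists $s\in\mathbb{N}$ with $E(f)(s)=0$, and for every such $s$, $T(f,\check{s})$ is an ordinary name of $\theta(\xi)$. -}

module Defs where

open import Data.Nat using (ℕ; zero; suc)
open import Data.Fin using (Fin; zero; suc)
open import Data.Product using (Σ; _×_; _,_; ∃)
open import Data.Sum using (_⊎_)
open import Relation.Nullary using (¬_)
open import Relation.Binary.PropositionalEquality using (_≡_)
open import Algebra.Structures using (IsCommutativeRing)
open import Relation.Binary.Structures using (IsStrictPartialOrder)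

-- The real numbers, axiomatised as a complete ordered field.
-- (agda-stdlib has no reals; any model of these axioms is (classically)
-- isomorphic to ℝ, and the theorem is stated for every such model.)

record RealField : Set₁ where
  infixl 7 _*_
  infixl 6 _+_
  infix 4 _≈_ _<_ _≤_
  field
    Carrier : Set
    _≈_ : Carrier → Carrier → Set
    _+_ _*_ : Carrier → Carrier → Carrier
    -_ : Carrier → Carrier
    0# 1# : Carrier
    _⁻¹ : Carrier → Carrier
    _<_ : Carrier → Carrier → Set
    isCommutativeRing : IsCommutativeRing _≈_ _+_ _*_ -_ 0# 1#
    ⁻¹-inverse : ∀ x → ¬ (x ≈ 0#) → x * (x ⁻¹) ≈ 1#
    0≉1 : ¬ (0# ≈ 1#)
    isStrictPartialOrder : IsStrictPartialOrder _≈_ _<_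
    <-connex : ∀ x y → ¬ (x < y) → ¬ (y < x) → x ≈ y
    +-mono-< : ∀ x y z → x < y → x + z < y + z
    *-pos : ∀ x y → 0# < x → 0# < y → 0# < x * y

  _≤_ : Carrier → Carrier → Set
  x ≤ y = (x < y) ⊎ (x ≈ y)

  field
    sup : (P : Carrier → Set) → (∃ λ x → P x) →
          (∃ λ b → ∀ x → P x → x ≤ b) →
          ∃ λ s → (∀ x → P x → x ≤ s) × (∀ b → (∀ x → P x → x ≤ b) → s ≤ b)

  fromℕ : ℕ → Carrier
  fromℕ zero = 0#
  fromℕ (suc n) = 1# + fromℕ n

  recipSuc : ℕ → Carrier
  recipSuc t = (fromℕ (suc t)) ⁻¹

-- Effective metric spaces (Weihrauch, Def. 8.1.2), over the reals ℝ.
-- The notation α of the dense set A is a partial map ℕ ⇀ M with domain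
-- Dom; A is its image {α n | Dom n}.

record EffMetricSpace (ℝ : RealField) : Set₁ where
  open RealField ℝ
  field
    M : Set
    d : M → M → Carrier
    d-nonneg : ∀ x y → 0# ≤ d x y
    d-zero⇒eq : ∀ x y → d x y ≈ 0# → x ≡ y
    eq⇒d-zero : ∀ x → d x x ≈ 0#
    d-sym : ∀ x y → d x y ≈ d y x
    d-tri : ∀ x y z → d x z ≤ d x y + d y z
    Dom : ℕ → Set
    α : ℕ → M
    dense : ∀ ξ ε → 0# < ε → ∃ λ n → Dom n × (d (α n) ξ < ε)

  IsName : (ℕ → ℕ) → M → Set
  IsName f ξ = ∀ t → Dom (f t) × (d (α (f t)) ξ < recipSuc t)

T₁ : Set
T₁ = ℕ → ℕ

Op : ℕ → Set
Op k = (Fin k → T₁) → T₁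

Class : Set₁
Class = ∀ k → Op k → Set

const : ℕ → T₁
const c _ = c

snoc : ∀ {k} → (Fin k → T₁) → T₁ → Fin (suc k) → T₁
snoc {zero} fs g zero = g
snoc {suc k} fs g zero = fs zero
snoc {suc k} fs g (suc i) = snoc (λ j → fs (suc j)) g i

args1 : T₁ → Fin 1 → T₁
args1 f zero = f

args2 : T₁ → T₁ → Fin 2 → T₁
args2 f g zero = f
args2 f g (suc zero) = g

record Appropriate (O : Class) : Set where
  field
    proj : ∀ k (i : Fin k) → O k (λ fs → fs i)
    comp : O 2 (λ fs n → fs zero (fs (suc zero) n))
    subst : ∀ k l (F : Op k) (Gs : Fin k → Op l) →
            O k F → (∀ i → O l (Gs i)) →
            O l (λ gs → F (λ i → Gs i gs))
    diag : ∀ k (F : Op (suc k)) → O (suc k) F →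
           O k (λ fs n → F (snoc fs (const n)) n)

-- Set-theoretic extensionality of membership in O (functions are equal
-- when pointwise equal).
Extensional : Class → Set
Extensional O = ∀ k (F G : Op k) →
  (∀ fs gs → (∀ i n → fs i n ≡ gs i n) → ∀ n → F fs n ≡ G gs n) →
  O k F → O k G

ring : ∀ {k} → ((Fin k → ℕ) → ℕ) → Op k
ring f fs n = f (λ i → fs i n)

Representable : Class → ∀ k → ((Fin k → ℕ) → ℕ) → Set
Representable O k f = O k (ring f)

record PartialFun {ℝ : RealField} (X Y : EffMetricSpace ℝ) : Set₁ where
  field
    D : EffMetricSpace.M X → Set
    θ : (ξ : EffMetricSpace.M X) → D ξ → EffMetricSpace.M Y

CondComputable : Class → {ℝ : RealField} {X Y : EffMetricSpace ℝ} →
                 PartialFun X Y → Set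
CondComputable O {ℝ} {X} {Y} P =
  Σ (Op 1) λ E → Σ (Op 2) λ T → O 1 E × O 2 T ×
    (∀ ξ (p : D ξ) f → EffMetricSpace.IsName X f ξ →
       (∃ λ s → E (args1 f) s ≡ 0) ×
       (∀ s → E (args1 f) s ≡ 0 →
          EffMetricSpace.IsName Y (T (args2 f (const s))) (θ ξ p)))
  where open PartialFun P

compose : {ℝ : RealField} {X Y Z : EffMetricSpace ℝ} →
          PartialFun Y Z → PartialFun X Y → PartialFun X Z
compose P₀ P₁ = record
  { D = λ ξ → Σ (PartialFun.D P₁ ξ) λ p → PartialFun.D P₀ (PartialFun.θ P₁ ξ p)
  ; θ = λ ξ q → PartialFun.θ P₀ (PartialFun.θ P₁ ξ (Data.Product.proj₁ q))
                  (Data.Product.proj₂ q)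
  }

module Submission where

-- Let (E₁, T₁) witness conditional computability of θ₁ and (E₀, T₀) that
-- of θ₀.  Given a name f of ξ, a parameter s₁ with E₁(f)(s₁) = 0 yields the
-- name g = T₁(f, č s₁) of θ₁(ξ), and a parameter s₂ with E₀(g)(s₂) = 0
-- yields the name T₀(g, č s₂) of θ₀(θ₁(ξ)).  Both searches are merged into
-- one by coding the pair (s₁, s₂) as a single s via the surjection
-- s ↦ (L s, R s), and the two zero-tests into one via C, which vanishes
-- exactly at (0, 0):
--   E(f)(s)   = C(E₁(f)(L s), E₀(T₁(f, č(L s)))(R s)),
--   T(f, h)   = T₀(T₁(f, L ∘ h), R ∘ h).

open import Defs
open import Data.Nat using (ℕ)
open import Data.Fin using (zero; suc)
open import Data.Product using (_×_; ∃; _,_; proj₂)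
open import Relation.Binary.PropositionalEquality using (_≡_; refl; trans; cong₂)

module Closure (O : Class) (appropriate : Appropriate O) where
  open Appropriate appropriate

  first : O 2 (λ fs → fs zero)
  first = proj 2 zero

  second : O 2 (λ fs → fs (suc zero))
  second = proj 2 (suc zero)

  plug₁ : ∀ {l} {F : Op 1} {H : Op l} → O 1 F → O l H →
          O l (λ gs → F (args1 (H gs)))
  plug₁ {l} {F} {H} oF oH =
    subst 1 l F (λ i gs → args1 (H gs) i) oF λ { zero → oH }

  plug₂ : ∀ {l} {F : Op 2} {H K : Op l} → O 2 F → O l H → O l K →
          O l (λ gs → F (args2 (H gs) (K gs)))
  plug₂ {l} {F} {H} {K} oF oH oK =
    subst 2 l F (λ i gs → args2 (H gs) (K gs) i) oF
      λ { zero → oH ; (suc zero) → oK }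

  after : ∀ {l} {H K : Op l} → O l H → O l K →
          O l (λ gs n → H gs (K gs n))
  after = plug₂ comp

  apply₁ : ∀ {l} (f : ℕ → ℕ) {H : Op l} →
           Representable O 1 (λ v → f (v zero)) → O l H →
           O l (λ gs n → f (H gs n))
  apply₁ f = plug₁

  apply₂ : ∀ {l} (f : ℕ → ℕ → ℕ) {H K : Op l} →
           Representable O 2 (λ v → f (v zero) (v (suc zero))) →
           O l H → O l K → O l (λ gs n → f (H gs n) (K gs n))
  apply₂ f = plug₂

module Composite (C : ℕ → ℕ → ℕ) (L R : ℕ → ℕ) (E₀ E₁ : Op 1) (T₀ T₁ : Op 2) where

  -- T₁(f, L ∘ h): a name of θ₁(ξ) when h is the constant code of s₁.
  innerName : Op 2
  innerName fs = T₁ (args2 (fs zero) (λ n → L (fs (suc zero) n)))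

  searchBody : Op 2
  searchBody fs n = C (E₁ (args1 (fs zero)) (L (fs (suc zero) n)))
                      (E₀ (args1 (innerName fs)) (R (fs (suc zero) n)))

  search : Op 1
  search fs n = searchBody (snoc fs (const n)) n

  transform : Op 2
  transform fs = T₀ (args2 (innerName fs) (λ n → R (fs (suc zero) n)))

  module Membership (O : Class) (appropriate : Appropriate O)
    (oC : Representable O 2 (λ v → C (v zero) (v (suc zero))))
    (oL : Representable O 1 (λ v → L (v zero)))
    (oR : Representable O 1 (λ v → R (v zero)))
    (oE₀ : O 1 E₀) (oT₀ : O 2 T₀) (oE₁ : O 1 E₁) (oT₁ : O 2 T₁) where
    open Appropriate appropriate
    open Closure O appropriate

    innerName∈O : O 2 innerName
    innerName∈O = plug₂ oT₁ first (apply₁ L oL second)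

    searchBody∈O : O 2 searchBody
    searchBody∈O =
      apply₂ C oC (after (plug₁ oE₁ first) (apply₁ L oL second))
                (after (plug₁ oE₀ innerName∈O) (apply₁ R oR second))

    search∈O : O 1 search
    search∈O = diag 1 searchBody searchBody∈O

    transform∈O : O 2 transform
    transform∈O = plug₂ oT₀ innerName∈O (apply₁ R oR second)

  module Zeros (C-zero⇒ : ∀ u v → C u v ≡ 0 → u ≡ 0 × v ≡ 0) (C00 : C 0 0 ≡ 0)
    (pairing : ∀ u v → ∃ λ s → L s ≡ u × R s ≡ v) (f : ℕ → ℕ) where

    inner : ℕ → ℕ → ℕ
    inner s₁ = T₁ (args2 f (const s₁))

    search-zero⇒ : ∀ s → search (args1 f) s ≡ 0 →
                   E₁ (args1 f) (L s) ≡ 0 × E₀ (args1 (inner (L s))) (R s) ≡ 0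
    search-zero⇒ s = C-zero⇒ _ _

    ⇒search-zero : ∀ s₁ s₂ → E₁ (args1 f) s₁ ≡ 0 → E₀ (args1 (inner s₁)) s₂ ≡ 0 →
                   ∃ λ s → search (args1 f) s ≡ 0
    ⇒search-zero s₁ s₂ e₁ e₀ with pairing s₁ s₂
    ... | s , refl , refl = s , trans (cong₂ C e₁ e₀) C00

theorem4 : (O : Class) → Appropriate O → Extensional O →
    (C : ℕ → ℕ → ℕ) (L R : ℕ → ℕ) →
    Representable O 2 (λ v → C (v zero) (v (suc zero))) →
    Representable O 1 (λ v → L (v zero)) →
    Representable O 1 (λ v → R (v zero)) →
    (∀ u v → C u v ≡ 0 → u ≡ 0 × v ≡ 0) → C 0 0 ≡ 0 →
    (∀ u v → ∃ λ s → L s ≡ u × R s ≡ v) →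
    (ℝ : RealField) (M₀ M₁ M₂ : EffMetricSpace ℝ)
    (θ₀ : PartialFun M₁ M₀) (θ₁ : PartialFun M₂ M₁) →
    CondComputable O θ₀ → CondComputable O θ₁ →
    CondComputable O (compose θ₀ θ₁)
theorem4 O appropriate _ C L R oC oL oR C-zero⇒ C00 pairing ℝ M₀ M₁ M₂ θ₀ θ₁
  (E₀ , T₀ , oE₀ , oT₀ , correct₀) (E₁ , T₁ , oE₁ , oT₁ , correct₁) =
  search , transform , search∈O , transform∈O , correct
  where
  open Composite C L R E₀ E₁ T₀ T₁
  open Membership O appropriate oC oL oR oE₀ oT₀ oE₁ oT₁
  open EffMetricSpace using (IsName)
  open PartialFun using (θ)

  correct : ∀ ξ (p : PartialFun.D (compose θ₀ θ₁) ξ) f → IsName M₂ f ξ →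
            (∃ λ s → search (args1 f) s ≡ 0) ×
            (∀ s → search (args1 f) s ≡ 0 →
               IsName M₀ (transform (args2 f (const s))) (θ (compose θ₀ θ₁) ξ p))
  correct ξ (p₁ , p₀) f name with correct₁ ξ p₁ f name
  ... | (s₁ , e₁) , names₁ with correct₀ (θ θ₁ ξ p₁) p₀ _ (names₁ s₁ e₁)
  ... | (s₂ , e₀) , _ = ⇒search-zero s₁ s₂ e₁ e₀ , names
    where
    open Zeros C-zero⇒ C00 pairing f
    names : ∀ s → search (args1 f) s ≡ 0 →
            IsName M₀ (transform (args2 f (const s))) (θ θ₀ (θ θ₁ ξ p₁) p₀)
    names s e with search-zero⇒ s e
    ... | eL , eR =
      proj₂ (correct₀ (θ θ₁ ξ p₁) p₀ (inner (L s)) (names₁ (L s) eL)) (R s) eR
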